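{- Let $\mathcal M$ be a countable relational homogeneous structure and $G=\mathrm{Aut}(\mathcal M)$. Suppose that $\langle G_{(A)},G_{(B)}\rangle=G_{(A\cap B)}$ holds for all finite $A,B\subseteq\mathcal M$ with $|A\setminus B|=|B\setminus A|=1$. Then $\langle G_{(A)},G_{(B)}\rangle=G_{(A\cap B)}$ holds for all finite subsets $A,B\subseteq\mathcal M$.
   Context: A structure is homogeneous if every isomorphism between finite substructures extends to an automorphism. For $A\subseteq\mathcal M$, $G_{(A)}$ denotes the pointwise stabiliser of $A$ in $G$, and $\langle H,K\rangle$ the subgroup generated by $H$ and $K$. -}

module Defs where

open import Data.Nat using (ℕ)
open import Data.Fin using (Fin)
open import Data.List using (List; [])
open import Data.List.Relation.Unary.All using (All)
open import Data.List.Membership.Propositional using (_∈_)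
open import Data.Product using (Σ; ∃; _×_; _,_; proj₁)
open import Data.Sum using (_⊎_)
open import Data.Bool using (Bool; true; false)
open import Function using (_∘_; id)
open import Function.Bundles using (_↔_; _⇔_; Inverse)
open import Function.Definitions using (Injective)
open import Relation.Nullary using (¬_)
open import Relation.Binary.PropositionalEquality using (_≡_)

record RelStructure : Set₁ where
  field
    Sym   : Set
    arity : Sym → ℕ
    M     : Set
    rel   : (R : Sym) → (Fin (arity R) → M) → Set

module _ (S : RelStructure) where
  open RelStructure S

  -- Countable: M injects into ℕ (classically equivalent to "at most countable").
  Countable : Set
  Countable = Σ (M → ℕ) (Injective _≡_ _≡_)

  record Aut : Set where
    field
      perm     : M ↔ M
      preserve : (R : Sym) (t : Fin (arity R) → M) →
                 rel R t ⇔ rel R (Inverse.to perm ∘ t)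

  apply : Aut → M → M
  apply g = Inverse.to (Aut.perm g)

  applyInv : Aut → M → M
  applyInv g = Inverse.from (Aut.perm g)

  -- This is exactly an isomorphism between the finite
  -- substructures A and f[A] (relational language: every subset is a substructure).
  record FinPartialIso (A : List M) (f : M → M) : Set where
    field
      inj      : ∀ x y → x ∈ A → y ∈ A → f x ≡ f y → x ≡ y
      preserve : (R : Sym) (t : Fin (arity R) → M) →
                 (∀ i → t i ∈ A) → rel R t ⇔ rel R (f ∘ t)

  Homogeneous : Set
  Homogeneous = (A : List M) (f : M → M) → FinPartialIso A f →
                Σ Aut λ g → ∀ x → x ∈ A → apply g x ≡ f x

  Stab : (M → Set) → Aut → Set
  Stab X g = ∀ x → X x → apply g x ≡ x

  -- Evaluation of a word in automorphisms and their inverses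
  -- (true = the element, false = its inverse), as a permutation of M.
  evalWord : List (Aut × Bool) → M → M
  evalWord [] = id
  evalWord ((g , true)  Data.List.∷ w) = apply g ∘ evalWord w
  evalWord ((g , false) Data.List.∷ w) = applyInv g ∘ evalWord w

  -- Membership in the subgroup ⟨H , K⟩ generated by H ∪ K: g is (pointwise)
  -- equal to a finite product of elements of H ∪ K and their inverses.
  Generated : (Aut → Set) → (Aut → Set) → Aut → Set
  Generated H K g =
    Σ (List (Aut × Bool)) λ w →
      All (λ p → H (proj₁ p) ⊎ K (proj₁ p)) w × (∀ x → evalWord w x ≡ apply g x)

  SameSubgroup : (Aut → Set) → (Aut → Set) → Set
  SameSubgroup H K = ∀ g → (H g → K g) × (K g → H g)

  -- Finite subsets are lists; these are the corresponding predicates.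
  ⟦_⟧ : List M → M → Set
  ⟦ A ⟧ x = x ∈ A

  _∩_ : List M → List M → M → Set
  (A ∩ B) x = x ∈ A × x ∈ B

  DiffSizeOne : List M → List M → Set
  DiffSizeOne A B = Σ M λ a → (a ∈ A × ¬ a ∈ B) × (∀ x → x ∈ A → ¬ x ∈ B → x ≡ a)

  GenProperty : List M → List M → Set
  GenProperty A B = SameSubgroup (Generated (Stab ⟦ A ⟧) (Stab ⟦ B ⟧)) (Stab (A ∩ B))

module Submission where

-- The inclusion ⟨G_(A), G_(B)⟩ ⊆ G_(A ∩ B) holds in general, since both
-- generating sets fix A ∩ B pointwise.  For the reverse inclusion we grow the
-- two sets one point at a time over a common base C, using two facts about
-- generated subgroups: monotonicity, and "absorption" (if H' and K' lie in
-- ⟨H, K⟩ then so does ⟨H', K'⟩).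
--   * two-point step:  G_(C) ⊆ ⟨G_(a ∷ C), G_(b ∷ C)⟩ for a ≠ b (the hypothesis,
--     or trivial when a or b already lies in C);
--   * one point against many:  G_(C) ⊆ ⟨G_(a ∷ C), G_(B' ++ C)⟩ for a ∉ B',
--     by induction on B';
--   * many against many:  G_(C) ⊆ ⟨G_(A' ++ C), G_(B' ++ C)⟩ for A', B'
--     disjoint, by induction on A'.
-- Taking C = A ∩ B, A' = A and B' = B ∖ A gives the theorem.  Countability is
-- used only to decide equality of points.

open import Defs
open import Data.List using (List; []; _∷_; _++_; filter)
open import Data.List.Relation.Unary.All using (All; []; _∷_; tabulate)
open import Data.List.Relation.Unary.All.Properties using (++⁺)
open import Data.List.Relation.Unary.Any using (here; there)
open import Data.List.Membership.Propositional using (_∈_; _∉_)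
open import Data.List.Membership.Propositional.Properties using (∈-filter⁺; ∈-filter⁻)
open import Data.List.Relation.Binary.Subset.Propositional using (_⊆_)
open import Data.List.Relation.Binary.Subset.Propositional.Properties
  using (xs⊆xs++ys; xs⊆ys++xs; ∷⁺ʳ; ++⁺ʳ; ∈-∷⁺ʳ)
import Data.List.Membership.DecPropositional as DecMembership
import Data.Nat.Properties as ℕ
open import Data.Product using (Σ; _×_; _,_; proj₁; proj₂)
open import Data.Sum using (_⊎_; inj₁; inj₂; [_,_])
open import Data.Bool using (Bool; true; false; not)
open import Data.Empty using (⊥-elim)
open import Function using (_∘_; id)
open import Function.Bundles using (Inverse)
open import Relation.Nullary using (Dec; yes; no; ¬?)
open import Relation.Nullary.Decidable using (map′)
open import Relation.Binary.Definitions using (DecidableEquality)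
open import Relation.Binary.PropositionalEquality
  using (_≡_; _≢_; refl; sym; trans; cong; module ≡-Reasoning)

module Generation (S : RelStructure) where
  open RelStructure S

  countable⇒decEq : Countable S → DecidableEquality M
  countable⇒decEq (code , code-injective) x y =
    map′ code-injective (cong code) (code x ℕ.≟ code y)

  _⊆ᴳ_ : (Aut S → Set) → (Aut S → Set) → Set
  H ⊆ᴳ K = ∀ g → H g → K g

  Word : Set
  Word = List (Aut S × Bool)

  Letters : (Aut S → Set) → (Aut S → Set) → Word → Set
  Letters H K = All (λ p → H (proj₁ p) ⊎ K (proj₁ p))

  _represents_ : Word → Aut S → Set
  w represents g = ∀ x → evalWord S w x ≡ apply S g x

  evalWord-++ : ∀ u v x → evalWord S (u ++ v) x ≡ evalWord S u (evalWord S v x)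
  evalWord-++ [] v x = refl
  evalWord-++ ((g , true) ∷ u) v x = cong (apply S g) (evalWord-++ u v x)
  evalWord-++ ((g , false) ∷ u) v x = cong (applyInv S g) (evalWord-++ u v x)

  invWord : Word → Word
  invWord [] = []
  invWord ((g , b) ∷ w) = invWord w ++ (g , not b) ∷ []

  invWord-letters : ∀ {H K} w → Letters H K w → Letters H K (invWord w)
  invWord-letters [] [] = []
  invWord-letters (_ ∷ w) (p ∷ ps) = ++⁺ (invWord-letters w ps) (p ∷ [])

  invWord-cancel : ∀ w x → evalWord S (invWord w) (evalWord S w x) ≡ x
  invWord-cancel [] x = refl
  invWord-cancel ((g , true) ∷ w) x = begin
    evalWord S (invWord w ++ (g , false) ∷ []) (apply S g (evalWord S w x))
      ≡⟨ evalWord-++ (invWord w) _ _ ⟩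
    evalWord S (invWord w) (applyInv S g (apply S g (evalWord S w x)))
      ≡⟨ cong (evalWord S (invWord w)) (Inverse.strictlyInverseʳ (Aut.perm g) _) ⟩
    evalWord S (invWord w) (evalWord S w x)
      ≡⟨ invWord-cancel w x ⟩
    x ∎
    where open ≡-Reasoning
  invWord-cancel ((g , false) ∷ w) x = begin
    evalWord S (invWord w ++ (g , true) ∷ []) (applyInv S g (evalWord S w x))
      ≡⟨ evalWord-++ (invWord w) _ _ ⟩
    evalWord S (invWord w) (apply S g (applyInv S g (evalWord S w x)))
      ≡⟨ cong (evalWord S (invWord w)) (Inverse.strictlyInverseˡ (Aut.perm g) _) ⟩
    evalWord S (invWord w) (evalWord S w x)
      ≡⟨ invWord-cancel w x ⟩
    x ∎
    where open ≡-Reasoning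

  invWord-represents : ∀ w g → w represents g → ∀ y → evalWord S (invWord w) y ≡ applyInv S g y
  invWord-represents w g w≈g y = begin
    evalWord S (invWord w) y
      ≡⟨ cong (evalWord S (invWord w)) (sym (Inverse.strictlyInverseˡ (Aut.perm g) y)) ⟩
    evalWord S (invWord w) (apply S g (applyInv S g y))
      ≡⟨ cong (evalWord S (invWord w)) (sym (w≈g _)) ⟩
    evalWord S (invWord w) (evalWord S w (applyInv S g y))
      ≡⟨ invWord-cancel w _ ⟩
    applyInv S g y ∎
    where open ≡-Reasoning

  generated-inl : ∀ {H K} → H ⊆ᴳ Generated S H K
  generated-inl g h = (g , true) ∷ [] , inj₁ h ∷ [] , λ _ → refl

  generated-inr : ∀ {H K} → K ⊆ᴳ Generated S H K
  generated-inr g k = (g , true) ∷ [] , inj₂ k ∷ [] , λ _ → refl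

  -- Absorption: ⟨H', K'⟩ is the least subgroup containing H' and K', so it
  -- lies in ⟨H, K⟩ as soon as both generating sets do.  Each letter of a word
  -- is replaced by a word over H ∪ K representing it (or its inverse).
  generated-least : ∀ {H K H' K'} → H' ⊆ᴳ Generated S H K → K' ⊆ᴳ Generated S H K →
                    Generated S H' K' ⊆ᴳ Generated S H K
  generated-least {H} {K} {H'} {K'} H'⊆ K'⊆ g (w , letters , w≈g) =
    let v , vs , v≈w = expand w letters in v , vs , λ x → trans (v≈w x) (w≈g x)
    where
    expand-letter : ∀ h → H' h ⊎ K' h → Generated S H K h
    expand-letter h = [ H'⊆ h , K'⊆ h ]
    expand : ∀ w → Letters H' K' w →
             Σ Word λ v → Letters H K v × (∀ x → evalWord S v x ≡ evalWord S w x)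
    expand [] [] = [] , [] , λ _ → refl
    expand ((h , true) ∷ w) (p ∷ ps)
      with expand-letter h p | expand w ps
    ... | u , us , u≈h | v , vs , v≈w = u ++ v , ++⁺ us vs , λ x →
      trans (evalWord-++ u v x) (trans (u≈h _) (cong (apply S h) (v≈w x)))
    expand ((h , false) ∷ w) (p ∷ ps)
      with expand-letter h p | expand w ps
    ... | u , us , u≈h | v , vs , v≈w = invWord u ++ v , ++⁺ (invWord-letters u us) vs , λ x →
      trans (evalWord-++ (invWord u) v x)
            (trans (invWord-represents u h u≈h _) (cong (applyInv S h) (v≈w x)))

  generated-mono : ∀ {H K H' K'} → H' ⊆ᴳ H → K' ⊆ᴳ K → Generated S H' K' ⊆ᴳ Generated S H K
  generated-mono H'⊆H K'⊆K =
    generated-least (λ g → generated-inl g ∘ H'⊆H g) (λ g → generated-inr g ∘ K'⊆K g)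

  inverse-fixes : ∀ g {x} → apply S g x ≡ x → applyInv S g x ≡ x
  inverse-fixes g {x} gx≡x = trans (cong (applyInv S g) (sym gx≡x))
                                   (Inverse.strictlyInverseʳ (Aut.perm g) x)

  generated-fixes : ∀ {H K X} → H ⊆ᴳ Stab S X → K ⊆ᴳ Stab S X → Generated S H K ⊆ᴳ Stab S X
  generated-fixes {H} {K} {X} H⊆ K⊆ g (w , letters , w≈g) x Xx =
    trans (sym (w≈g x)) (word-fixes w letters)
    where
    letter-fixes : ∀ h → H h ⊎ K h → apply S h x ≡ x
    letter-fixes h = [ (λ p → H⊆ h p x Xx) , (λ p → K⊆ h p x Xx) ]
    word-fixes : ∀ w → Letters H K w → evalWord S w x ≡ x
    word-fixes [] [] = refl
    word-fixes ((h , true) ∷ w) (p ∷ ps) =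
      trans (cong (apply S h) (word-fixes w ps)) (letter-fixes h p)
    word-fixes ((h , false) ∷ w) (p ∷ ps) =
      trans (cong (applyInv S h) (word-fixes w ps)) (inverse-fixes h (letter-fixes h p))

  Fix : List M → Aut S → Set
  Fix X = Stab S (⟦_⟧ S X)

  Fix-anti : ∀ {X Y} → X ⊆ Y → Fix Y ⊆ᴳ Fix X
  Fix-anti X⊆Y g fixesY x x∈X = fixesY x (X⊆Y x∈X)

  generated-Fix-mono : ∀ {X Y X' Y'} → X ⊆ X' → Y ⊆ Y' →
                       Generated S (Fix X') (Fix Y') ⊆ᴳ Generated S (Fix X) (Fix Y)
  generated-Fix-mono X⊆X' Y⊆Y' = generated-mono (Fix-anti X⊆X') (Fix-anti Y⊆Y')

  generated⊆Fix∩ : ∀ A B → Generated S (Fix A) (Fix B) ⊆ᴳ Stab S (_∩_ S A B)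
  generated⊆Fix∩ A B = generated-fixes (λ h fixesA x x∈A∩B → fixesA x (proj₁ x∈A∩B))
                                       (λ h fixesB x x∈A∩B → fixesB x (proj₂ x∈A∩B))

  cons-diffSizeOne : ∀ D {a b} → a ∉ D → a ≢ b → DiffSizeOne S (a ∷ D) (b ∷ D)
  cons-diffSizeOne D {a} {b} a∉D a≢b = a , (here refl , a∉b∷D) , only-a
    where
    a∉b∷D : a ∉ b ∷ D
    a∉b∷D (here a≡b) = a≢b a≡b
    a∉b∷D (there a∈D) = a∉D a∈D
    only-a : ∀ x → x ∈ a ∷ D → x ∉ b ∷ D → x ≡ a
    only-a x (here x≡a) _ = x≡a
    only-a x (there x∈D) x∉b∷D = ⊥-elim (x∉b∷D (there x∈D))

  cons-∩-cons : ∀ (D : List M) {a b x} → a ≢ b → x ∈ a ∷ D → x ∈ b ∷ D → x ∈ D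
  cons-∩-cons D a≢b (there x∈D) _ = x∈D
  cons-∩-cons D a≢b (here refl) (there x∈D) = x∈D
  cons-∩-cons D a≢b (here refl) (here refl) = ⊥-elim (a≢b refl)

module Reduction (S : RelStructure) (_≟_ : DecidableEquality (RelStructure.M S))
  (one-point-case : (A B : List (RelStructure.M S)) →
                    DiffSizeOne S A B → DiffSizeOne S B A → GenProperty S A B) where
  open RelStructure S
  open Generation S
  open DecMembership _≟_ using (_∈?_)

  ⟨_,_⟩ : List M → List M → Aut S → Set
  ⟨ X , Y ⟩ = Generated S (Fix X) (Fix Y)

  -- The hypothesis, extended to the degenerate cases where a or b lies in D.
  two-point : ∀ D a b → a ≢ b → Fix D ⊆ᴳ ⟨ a ∷ D , b ∷ D ⟩
  two-point D a b a≢b g fixesD with a ∈? D | b ∈? D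
  ... | yes a∈D | _ = generated-inl g (Fix-anti (∈-∷⁺ʳ a∈D id) g fixesD)
  ... | no _ | yes b∈D = generated-inr g (Fix-anti (∈-∷⁺ʳ b∈D id) g fixesD)
  ... | no a∉D | no b∉D =
    proj₂ (one-point-case (a ∷ D) (b ∷ D) (cons-diffSizeOne D a∉D a≢b)
                          (cons-diffSizeOne D b∉D (a≢b ∘ sym)) g)
          (λ x x∈∩ → fixesD x (cons-∩-cons D a≢b (proj₁ x∈∩) (proj₂ x∈∩)))

  -- Induction on B': absorb G_(B' ++ C) into ⟨G_(a ∷ C), G_(b ∷ B' ++ C)⟩ via two-point.
  one-against-many : ∀ C a B' → a ∉ B' → Fix C ⊆ᴳ ⟨ a ∷ C , B' ++ C ⟩
  one-against-many C a [] _ = generated-inr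
  one-against-many C a (b ∷ B') a∉b∷B' g fixesC =
    generated-least generated-inl grow-right g
      (one-against-many C a B' (a∉b∷B' ∘ there) g fixesC)
    where
    grow-right : Fix (B' ++ C) ⊆ᴳ ⟨ a ∷ C , b ∷ B' ++ C ⟩
    grow-right h fixes = generated-Fix-mono (∷⁺ʳ a (xs⊆ys++xs C B')) id h
      (two-point (B' ++ C) a b (a∉b∷B' ∘ here) h fixes)

  -- Induction on A': absorb G_(A' ++ C) into ⟨G_(a ∷ A' ++ C), G_(B' ++ C)⟩ via
  -- one-against-many; A' and B' must be disjoint.
  many-against-many : ∀ C A' B' → All (_∉ B') A' → Fix C ⊆ᴳ ⟨ A' ++ C , B' ++ C ⟩
  many-against-many C [] B' [] = generated-inl
  many-against-many C (a ∷ A') B' (a∉B' ∷ disjoint) g fixesC =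
    generated-least grow-left generated-inr g
      (many-against-many C A' B' disjoint g fixesC)
    where
    grow-left : Fix (A' ++ C) ⊆ᴳ ⟨ a ∷ A' ++ C , B' ++ C ⟩
    grow-left h fixes = generated-Fix-mono id (++⁺ʳ B' (xs⊆ys++xs C A')) h
      (one-against-many (A' ++ C) a B' a∉B' h fixes)

  -- The hard inclusion G_(A ∩ B) ⊆ ⟨G_(A), G_(B)⟩, with C = A ∩ B, A' = A, B' = B ∖ A.
  Fix∩⊆generated : ∀ A B → Stab S (_∩_ S A B) ⊆ᴳ ⟨ A , B ⟩
  Fix∩⊆generated A B g fixes∩ =
    generated-Fix-mono (xs⊆xs++ys A C) B⊆B'++C g
      (many-against-many C A B' (tabulate λ x∈A x∈B' → proj₂ (∈-filter⁻ ∉A {xs = B} x∈B') x∈A)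
                         g (λ x x∈C → fixes∩ x (∈-filter⁻ (_∈? B) {xs = A} x∈C)))
    where
    ∉A : ∀ x → Dec (x ∉ A)
    ∉A x = ¬? (x ∈? A)
    C B' : List M
    C = filter (_∈? B) A
    B' = filter ∉A B
    B⊆B'++C : B ⊆ B' ++ C
    B⊆B'++C {x} x∈B with x ∈? A
    ... | yes x∈A = xs⊆ys++xs C B' (∈-filter⁺ (_∈? B) x∈A x∈B)
    ... | no x∉A = xs⊆xs++ys B' C (∈-filter⁺ ∉A x∈B x∉A)

  genProperty : ∀ A B → GenProperty S A B
  genProperty A B g = generated⊆Fix∩ A B g , Fix∩⊆generated A B g

proposition4p3 : (S : RelStructure) → Countable S → Homogeneous S →
    ((A B : List (RelStructure.M S)) → DiffSizeOne S A B → DiffSizeOne S B A → GenProperty S A B) →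
    (A B : List (RelStructure.M S)) → GenProperty S A B
proposition4p3 S countable _ one-point-case =
  Reduction.genProperty S (Generation.countable⇒decEq S countable) one-point-case
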